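{- Let $q$ be a prime power, $r\geq 1$, and let $\tau$ be a permutation of $F_q^r$ with $\tau({\bf 0})={\bf 0}$. For each $a\in F_q^r$ choose an arbitrary $x_a\in C_a$ and let $y_a=e_{\bf 0}-e_a$. Then for any coefficients $\alpha_a\in F_q$, $a\in F_q^r$, $$\sum_{a\in F_q^r}\alpha_a x_a\in C \quad\text{if and only if}\quad \sum_{a\in F_q^r}\alpha_a y_{\tau(a)}\in \tau(D).$$
   Context: Let $n=\frac{q^r-1}{q-1}$. Let $H_C$ be an $r\times n$ matrix over $F_q$ whose columns are representatives of the $n$ distinct one-dimensional subspaces of $F_q^r$, $C=\{x\in F_q^n: H_Cx^T={\bf 0}\}$ (the $q$-ary Hamming code), and for $a\in F_q^r$, $C_a=\{x\in F_q^n: H_Cx^T=a\}$. Let $D$ be the linear code of length $q^r$ with coordinate positions indexed by vectors of $F_q^r$, $D=\{y=(y_a)_{a\in F_q^r}: \sum_a y_a=0,\ \sum_a y_a a={\bf 0}\}$ (equivalently, with parity check matrix whose column at position $a$ is $\binom{1}{a}$). $e_a$ denotes the length-$q^r$ vector with $1$ in position $a$ and $0$ elsewhere. A permutation $\tau$ of $F_q^r$ acts on vectors of length $q^r$ by permuting positions: $\tau(e_a)=e_{\tau(a)}$, extended linearly; $\tau(D)=\{\tau(y):y\in D\}$. -}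

module Defs where

open import Data.Nat using (ℕ; zero; suc; _≤_; _^_)
open import Data.Nat.Primality using (Prime)
open import Data.Fin using (Fin)
open import Data.Fin as Fin using ()
open import Data.Vec using (Vec; []; _∷_; zipWith; map; replicate)
open import Data.Vec.Properties using (≡-dec)
open import Data.Product using (Σ; ∃; _×_; _,_)
open import Data.Bool using (if_then_else_)
open import Algebra.Core using (Op₁; Op₂)
open import Algebra.Structures using (IsCommutativeRing)
open import Relation.Binary.PropositionalEquality using (_≡_)
open import Relation.Binary.Definitions using (DecidableEquality)
open import Relation.Nullary using (¬_; does)
open import Function.Bundles using (_↔_; Inverse)

IsPrimePower : ℕ → Set
IsPrimePower q = Σ ℕ λ p → Σ ℕ λ k → Prime p × 1 ≤ k × q ≡ p ^ k

-- A finite field: a commutative ring (with ≡ as equality) in which 0 ≠ 1 and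
-- every nonzero element is invertible, with decidable equality and an
-- explicit enumeration  Fin size ↔ Carrier  (so size = q = |F_q|).
record FiniteField : Set₁ where
  field
    Carrier : Set
    _+_ _*_ : Op₂ Carrier
    -_ : Op₁ Carrier
    0# 1# : Carrier
    isCommutativeRing : IsCommutativeRing _≡_ _+_ _*_ -_ 0# 1#
    0≢1 : ¬ (0# ≡ 1#)
    inverse : ∀ x → ¬ (x ≡ 0#) → ∃ λ y → x * y ≡ 1#
    _≟_ : DecidableEquality Carrier
    size : ℕ
    enum : Fin size ↔ Carrier

module FF (F : FiniteField) where
  open FiniteField F

  sumFin : {A : Set} → Op₂ A → A → ∀ {m} → (Fin m → A) → A
  sumFin _⊕_ e {zero} f = e
  sumFin _⊕_ e {suc m} f = f Fin.zero ⊕ sumFin _⊕_ e (λ i → f (Fin.suc i))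

  sumF : {A : Set} → Op₂ A → A → (Carrier → A) → A
  sumF _⊕_ e f = sumFin _⊕_ e (λ i → f (Inverse.to enum i))

  sumAll : {A : Set} → Op₂ A → A → ∀ r → (Vec Carrier r → A) → A
  sumAll _⊕_ e zero f = f []
  sumAll _⊕_ e (suc r) f = sumF _⊕_ e (λ c → sumAll _⊕_ e r (λ v → f (c ∷ v)))

  _⊕_ : ∀ {m} → Op₂ (Vec Carrier m)
  _⊕_ = zipWith _+_

  _·_ : ∀ {m} → Carrier → Vec Carrier m → Vec Carrier m
  c · v = map (c *_) v

  𝟎 : ∀ m → Vec Carrier m
  𝟎 m = replicate m 0#

  -- H is an r × n matrix (given by its n columns) whose columns are
  -- representatives of the distinct one-dimensional subspaces of F_q^r
  IsHammingMatrix : ∀ r n → (Fin n → Vec Carrier r) → Set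
  IsHammingMatrix r n H =
      (∀ j → ¬ (H j ≡ 𝟎 r))
    × (∀ j k (c : Carrier) → H j ≡ c · H k → j ≡ k)
    × (∀ v → ¬ (v ≡ 𝟎 r) → Σ (Fin n) λ j → Σ Carrier λ c → v ≡ c · H j)

  syndrome : ∀ {r n} → (Fin n → Vec Carrier r) → Vec Carrier n → Vec Carrier r
  syndrome {r} H x = sumFin _⊕_ (𝟎 r) (λ j → Data.Vec.lookup x j · H j)

  InCoset : ∀ {r n} → (Fin n → Vec Carrier r) → Vec Carrier r → Vec Carrier n → Set
  InCoset H a x = syndrome H x ≡ a

  InC : ∀ {r n} → (Fin n → Vec Carrier r) → Vec Carrier n → Set
  InC {r} H x = InCoset H (𝟎 r) x

  -- vectors of length q^r indexed by F_q^r
  Word : ℕ → Set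
  Word r = Vec Carrier r → Carrier

  e : ∀ {r} → Vec Carrier r → Word r
  e a b = if does (≡-dec _≟_ b a) then 1# else 0#

  y : ∀ {r} → Vec Carrier r → Word r
  y {r} a b = e (𝟎 r) b + (- e a b)

  InD : ∀ r → Word r → Set
  InD r w = sumAll _+_ 0# r w ≡ 0#
          × sumAll _⊕_ (𝟎 r) r (λ a → w a · a) ≡ 𝟎 r

  -- action of a permutation τ on words: τ(e_a) = e_{τ(a)}, i.e. (τ w)_b = w_{τ⁻¹ b}
  act : ∀ {r} → (Vec Carrier r ↔ Vec Carrier r) → Word r → Word r
  act τ w b = w (Inverse.from τ b)

  InτD : ∀ r → (Vec Carrier r ↔ Vec Carrier r) → Word r → Set
  InτD r τ z = Σ (Word r) λ w → InD r w × (∀ b → act τ w b ≡ z b)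

{-# OPTIONS --safe #-}
module Submission where

-- The syndrome is linear, so H(Σₐ αₐ xₐ) = Σₐ αₐ a. On the other side, since τ fixes 0,
-- reading Σₐ αₐ y_{τ(a)} through τ gives the word w = (Σₐ αₐ) e₀ − α, which lies in D
-- exactly when its first moment Σ_b w_b b = −Σₐ αₐ a vanishes: its coordinate sum is
-- always 0. So both sides say Σₐ αₐ a = 0.

open import Defs
open import Data.Nat using (ℕ; zero; suc)
open import Data.Fin as Fin using (Fin)
open import Data.Fin.Properties using (suc-injective)
open import Data.Vec using (Vec; []; _∷_)
open import Data.Vec.Properties
  using (≡-dec; ∷-injectiveˡ; ∷-injectiveʳ; lookup-zipWith; lookup-map; lookup-replicate;
         zipWith-assoc; zipWith-comm; zipWith-identityˡ; zipWith-identityʳ)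
open import Data.Product using (_,_; proj₂)
open import Data.Empty using (⊥-elim)
open import Relation.Binary.PropositionalEquality
  using (_≡_; _≢_; _≗_; refl; sym; trans; cong; cong₂; module ≡-Reasoning)
open import Relation.Binary.PropositionalEquality.Algebra using (isMagma)
open import Relation.Nullary using (yes; no)
open import Function.Base using (_∘_; const)
open import Function.Bundles using (_↔_; _⇔_; Inverse; Injection; Equivalence; mk⇔)
open import Function.Definitions using (Injective)
open import Function.Properties.Inverse using (↔⇒↣)
import Function.Properties.Equivalence as ⇔
open import Algebra.Core using (Op₂)
open import Algebra.Structures using (IsCommutativeMonoid)
open import Algebra.Bundles using (CommutativeRing; CommutativeSemigroup)
import Algebra.Properties.CommutativeSemigroup as CommutativeSemigroupProperties
import Algebra.Properties.Ring as RingProperties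

module Sums (F : FiniteField) where
  open FiniteField F using (Carrier; size; enum)
  open FF F using (sumFin; sumAll)
  open Inverse enum using (to; from; strictlyInverseˡ; strictlyInverseʳ)

  module _ {A : Set} (_∙_ : Op₂ A) (ε : A) where

    sumFin-cong : ∀ {m} {f g : Fin m → A} → f ≗ g → sumFin _∙_ ε f ≡ sumFin _∙_ ε g
    sumFin-cong {zero}  f≗g = refl
    sumFin-cong {suc m} f≗g = cong₂ _∙_ (f≗g Fin.zero) (sumFin-cong (f≗g ∘ Fin.suc))

    sumAll-cong : ∀ r {f g : Vec Carrier r → A} → f ≗ g → sumAll _∙_ ε r f ≡ sumAll _∙_ ε r g
    sumAll-cong zero    f≗g = f≗g []
    sumAll-cong (suc r) f≗g = sumFin-cong {size} (λ i → sumAll-cong r (λ v → f≗g (to i ∷ v)))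

  module _ {A B : Set} (_∙_ : Op₂ A) (ε : A) (_◇_ : Op₂ B) (ε′ : B) (h : A → B)
           (h-∙ : ∀ a b → h (a ∙ b) ≡ h a ◇ h b) (h-ε : h ε ≡ ε′) where

    sumFin-hom : ∀ {m} (f : Fin m → A) → h (sumFin _∙_ ε f) ≡ sumFin _◇_ ε′ (h ∘ f)
    sumFin-hom {zero}  f = h-ε
    sumFin-hom {suc m} f = trans (h-∙ _ _) (cong (h (f Fin.zero) ◇_) (sumFin-hom (f ∘ Fin.suc)))

    sumAll-hom : ∀ r (f : Vec Carrier r → A) → h (sumAll _∙_ ε r f) ≡ sumAll _◇_ ε′ r (h ∘ f)
    sumAll-hom zero    f = refl
    sumAll-hom (suc r) f =
      trans (sumFin-hom {size} _)
            (sumFin-cong _◇_ ε′ {size} (λ i → sumAll-hom r (λ v → f (to i ∷ v))))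

  module _ {A : Set} {_∙_ : Op₂ A} {ε : A} (isCM : IsCommutativeMonoid _≡_ _∙_ ε) where
    open IsCommutativeMonoid isCM using (identityˡ; identityʳ)

    private
      commutativeSemigroup : CommutativeSemigroup _ _
      commutativeSemigroup = record
        { isCommutativeSemigroup = IsCommutativeMonoid.isCommutativeSemigroup isCM }

    open CommutativeSemigroupProperties commutativeSemigroup using (interchange)

    sumFin-ε : ∀ {m} {f : Fin m → A} → f ≗ const ε → sumFin _∙_ ε f ≡ ε
    sumFin-ε {zero}  f≗ε = refl
    sumFin-ε {suc m} f≗ε =
      trans (cong₂ _∙_ (f≗ε Fin.zero) (sumFin-ε (f≗ε ∘ Fin.suc))) (identityˡ ε)

    sumAll-ε : ∀ r {f : Vec Carrier r → A} → f ≗ const ε → sumAll _∙_ ε r f ≡ ε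
    sumAll-ε zero    f≗ε = f≗ε []
    sumAll-ε (suc r) f≗ε = sumFin-ε {size} (λ i → sumAll-ε r (λ v → f≗ε (to i ∷ v)))

    sumFin-∙ : ∀ {m} (f g : Fin m → A) →
               sumFin _∙_ ε (λ i → f i ∙ g i) ≡ sumFin _∙_ ε f ∙ sumFin _∙_ ε g
    sumFin-∙ {zero}  f g = sym (identityˡ ε)
    sumFin-∙ {suc m} f g =
      trans (cong (_ ∙_) (sumFin-∙ (f ∘ Fin.suc) (g ∘ Fin.suc))) (interchange _ _ _ _)

    sumAll-∙ : ∀ r (f g : Vec Carrier r → A) →
               sumAll _∙_ ε r (λ v → f v ∙ g v) ≡ sumAll _∙_ ε r f ∙ sumAll _∙_ ε r g
    sumAll-∙ zero    f g = refl
    sumAll-∙ (suc r) f g =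
      trans (sumFin-cong _∙_ ε {size} (λ i → sumAll-∙ r _ _)) (sumFin-∙ {size} _ _)

    sumFin-single : ∀ {m} (f : Fin m → A) j → (∀ i → i ≢ j → f i ≡ ε) → sumFin _∙_ ε f ≡ f j
    sumFin-single f Fin.zero    f≡ε =
      trans (cong (f Fin.zero ∙_) (sumFin-ε (λ i → f≡ε (Fin.suc i) (λ ())))) (identityʳ _)
    sumFin-single f (Fin.suc j) f≡ε =
      trans (cong₂ _∙_ (f≡ε Fin.zero (λ ()))
                       (sumFin-single (f ∘ Fin.suc) j
                         (λ i i≢j → f≡ε (Fin.suc i) (i≢j ∘ suc-injective))))
            (identityˡ _)

    sumAll-single : ∀ r (f : Vec Carrier r → A) c → (∀ b → b ≢ c → f b ≡ ε) →
                    sumAll _∙_ ε r f ≡ f c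
    sumAll-single zero    f [] f≡ε = refl
    sumAll-single (suc r) f (c ∷ cs) f≡ε = begin
      sumFin _∙_ ε (λ i → sumAll _∙_ ε r (λ v → f (to i ∷ v)))
        ≡⟨ sumFin-single {size} _ (from c) off-c ⟩
      sumAll _∙_ ε r (λ v → f (to (from c) ∷ v))
        ≡⟨ cong (λ d → sumAll _∙_ ε r (λ v → f (d ∷ v))) (strictlyInverseˡ c) ⟩
      sumAll _∙_ ε r (λ v → f (c ∷ v))
        ≡⟨ sumAll-single r _ cs (λ b b≢cs → f≡ε (c ∷ b) (b≢cs ∘ ∷-injectiveʳ)) ⟩
      f (c ∷ cs) ∎
      where
      open ≡-Reasoning
      off-c : ∀ i → i ≢ from c → sumAll _∙_ ε r (λ v → f (to i ∷ v)) ≡ ε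
      off-c i i≢ = sumAll-ε r (λ v → f≡ε (to i ∷ v) λ eq →
        i≢ (trans (sym (strictlyInverseʳ i)) (cong from (∷-injectiveˡ eq))))

module Vectors (F : FiniteField) where
  open FiniteField F
  open FF F
  open Sums F

  commutativeRing : CommutativeRing _ _
  commutativeRing = record { isCommutativeRing = isCommutativeRing }

  open CommutativeRing commutativeRing
    using (+-assoc; +-comm; +-identityˡ; +-identityʳ; *-assoc; *-identityˡ;
           distribˡ; distribʳ; zeroˡ; zeroʳ; ring)
  open RingProperties ring using (-‿involutive; -1*x≈-x)
  open ≡-Reasoning

  ⊕-isCommutativeMonoid : ∀ k → IsCommutativeMonoid _≡_ (_⊕_ {k}) (𝟎 k)
  ⊕-isCommutativeMonoid k = record
    { isMonoid = record
      { isSemigroup = record { isMagma = isMagma _⊕_ ; assoc = zipWith-assoc +-assoc }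
      ; identity    = zipWith-identityˡ +-identityˡ , zipWith-identityʳ +-identityʳ
      }
    ; comm = zipWith-comm +-comm
    }

  ·-distrib-⊕ : ∀ {k} c (u v : Vec Carrier k) → c · (u ⊕ v) ≡ (c · u) ⊕ (c · v)
  ·-distrib-⊕ c []       []       = refl
  ·-distrib-⊕ c (a ∷ u) (b ∷ v) = cong₂ _∷_ (distribˡ c a b) (·-distrib-⊕ c u v)

  ·-𝟎 : ∀ {k} c → c · 𝟎 k ≡ 𝟎 k
  ·-𝟎 {zero}  c = refl
  ·-𝟎 {suc k} c = cong₂ _∷_ (zeroʳ c) (·-𝟎 c)

  sumAll-· : ∀ {k} r c (f : Vec Carrier r → Vec Carrier k) →
             sumAll _⊕_ (𝟎 k) r (λ a → c · f a) ≡ c · sumAll _⊕_ (𝟎 k) r f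
  sumAll-· {k} r c f =
    sym (sumAll-hom _⊕_ (𝟎 k) _⊕_ (𝟎 k) (c ·_) (·-distrib-⊕ c) (·-𝟎 c) r f)

  +-distrib-· : ∀ {k} c d (v : Vec Carrier k) → (c + d) · v ≡ (c · v) ⊕ (d · v)
  +-distrib-· c d []      = refl
  +-distrib-· c d (a ∷ v) = cong₂ _∷_ (distribʳ a c d) (+-distrib-· c d v)

  0#-· : ∀ {k} (v : Vec Carrier k) → 0# · v ≡ 𝟎 k
  0#-· []      = refl
  0#-· (a ∷ v) = cong₂ _∷_ (zeroˡ a) (0#-· v)

  1#-· : ∀ {k} (v : Vec Carrier k) → 1# · v ≡ v
  1#-· []      = refl
  1#-· (a ∷ v) = cong₂ _∷_ (*-identityˡ a) (1#-· v)

  *-· : ∀ {k} c d (v : Vec Carrier k) → (c * d) · v ≡ c · (d · v)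
  *-· c d []      = refl
  *-· c d (a ∷ v) = cong₂ _∷_ (*-assoc c d a) (*-· c d v)

  -c·v≡-1·[c·v] : ∀ {k} c (v : Vec Carrier k) → (- c) · v ≡ (- 1#) · (c · v)
  -c·v≡-1·[c·v] c v = trans (cong (_· v) (sym (-1*x≈-x c))) (*-· (- 1#) c v)

  -1·v≡𝟎⇔v≡𝟎 : ∀ {k} (v : Vec Carrier k) → (- 1#) · v ≡ 𝟎 k ⇔ v ≡ 𝟎 k
  -1·v≡𝟎⇔v≡𝟎 {k} v = mk⇔ ⇒ (λ v≡𝟎 → trans (cong ((- 1#) ·_) v≡𝟎) (·-𝟎 (- 1#)))
    where
    ⇒ : (- 1#) · v ≡ 𝟎 k → v ≡ 𝟎 k
    ⇒ -v≡𝟎 = begin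
      v                         ≡⟨ 1#-· v ⟨
      1# · v                    ≡⟨ cong (_· v) (sym (trans (-1*x≈-x (- 1#)) (-‿involutive 1#))) ⟩
      ((- 1#) * (- 1#)) · v     ≡⟨ *-· (- 1#) (- 1#) v ⟩
      (- 1#) · ((- 1#) · v)     ≡⟨ cong ((- 1#) ·_) -v≡𝟎 ⟩
      (- 1#) · 𝟎 k              ≡⟨ ·-𝟎 (- 1#) ⟩
      𝟎 k                       ∎

  module _ {r n} (H : Fin n → Vec Carrier r) where

    syndrome-⊕ : ∀ u v → syndrome H (u ⊕ v) ≡ syndrome H u ⊕ syndrome H v
    syndrome-⊕ u v =
      trans (sumFin-cong _⊕_ (𝟎 r)
              (λ j → trans (cong (_· H j) (lookup-zipWith _+_ j u v)) (+-distrib-· _ _ (H j))))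
            (sumFin-∙ (⊕-isCommutativeMonoid r) {n} _ _)

    syndrome-𝟎 : syndrome H (𝟎 n) ≡ 𝟎 r
    syndrome-𝟎 = sumFin-ε (⊕-isCommutativeMonoid r)
      (λ j → trans (cong (_· H j) (lookup-replicate j 0#)) (0#-· (H j)))

    syndrome-· : ∀ c u → syndrome H (c · u) ≡ c · syndrome H u
    syndrome-· c u =
      trans (sumFin-cong _⊕_ (𝟎 r)
              (λ j → trans (cong (_· H j) (lookup-map j (c *_) u)) (*-· c _ (H j))))
            (sym (sumFin-hom _⊕_ (𝟎 r) _⊕_ (𝟎 r) (c ·_) (·-distrib-⊕ c) (·-𝟎 c) {n} _))

    syndrome-linearCombination : ∀ m (α : Vec Carrier m → Carrier)
                                 (x : Vec Carrier m → Vec Carrier n) →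
      syndrome H (sumAll _⊕_ (𝟎 n) m (λ a → α a · x a))
        ≡ sumAll _⊕_ (𝟎 r) m (λ a → α a · syndrome H (x a))
    syndrome-linearCombination m α x =
      trans (sumAll-hom _⊕_ (𝟎 n) _⊕_ (𝟎 r) (syndrome H) syndrome-⊕ syndrome-𝟎 m _)
            (sumAll-cong _⊕_ (𝟎 r) m (λ a → syndrome-· (α a) (x a)))

module Words (F : FiniteField) where
  open FiniteField F
  open FF F
  open Sums F
  open Vectors F
  open CommutativeRing commutativeRing
    using (+-isCommutativeMonoid; -‿inverseʳ; *-identityʳ;
           distribˡ; distribʳ; zeroˡ; zeroʳ; ring)
  open RingProperties ring using (-0#≈0#; -‿+-comm; x[y-z]≈xy-xz)
  open ≡-Reasoning

  e-diag : ∀ {r} (a : Vec Carrier r) → e a a ≡ 1#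
  e-diag a with ≡-dec _≟_ a a
  ... | yes _   = refl
  ... | no  a≢a = ⊥-elim (a≢a refl)

  e-offdiag : ∀ {r} {a b : Vec Carrier r} → b ≢ a → e a b ≡ 0#
  e-offdiag {a = a} {b} b≢a with ≡-dec _≟_ b a
  ... | yes b≡a = ⊥-elim (b≢a b≡a)
  ... | no  _   = refl

  e-injective : ∀ {r} {T : Vec Carrier r → Vec Carrier r} → Injective _≡_ _≡_ T →
                ∀ a b → e (T a) (T b) ≡ e a b
  e-injective {T = T} T-inj a b with ≡-dec _≟_ b a
  ... | yes refl = e-diag (T a)
  ... | no  b≢a  = e-offdiag (b≢a ∘ T-inj)

  sumAll-e : ∀ r (c : Vec Carrier r) → sumAll _+_ 0# r (e c) ≡ 1#
  sumAll-e r c = trans (sumAll-single +-isCommutativeMonoid r (e c) c (λ b → e-offdiag)) (e-diag c)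

  sumAll-*-e : ∀ r (f : Vec Carrier r → Carrier) b → sumAll _+_ 0# r (λ a → f a * e a b) ≡ f b
  sumAll-*-e r f b =
    trans (sumAll-single +-isCommutativeMonoid r _ b
            (λ a a≢b → trans (cong (f a *_) (e-offdiag (a≢b ∘ sym))) (zeroʳ (f a))))
          (trans (cong (f b *_) (e-diag b)) (*-identityʳ (f b)))

  sumAll-*ˡ : ∀ r c (f : Vec Carrier r → Carrier) →
              sumAll _+_ 0# r (λ a → c * f a) ≡ c * sumAll _+_ 0# r f
  sumAll-*ˡ r c f = sym (sumAll-hom _+_ 0# _+_ 0# (c *_) (distribˡ c) (zeroʳ c) r f)

  sumAll-*ʳ : ∀ r c (f : Vec Carrier r → Carrier) →
              sumAll _+_ 0# r (λ a → f a * c) ≡ sumAll _+_ 0# r f * c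
  sumAll-*ʳ r c f = sym (sumAll-hom _+_ 0# _+_ 0# (_* c) (λ a b → distribʳ c a b) (zeroˡ c) r f)

  sumAll-neg : ∀ r (f : Vec Carrier r → Carrier) →
               sumAll _+_ 0# r (λ a → - f a) ≡ - sumAll _+_ 0# r f
  sumAll-neg r f = sym (sumAll-hom _+_ 0# _+_ 0# -_ (λ a b → sym (-‿+-comm a b)) -0#≈0# r f)

  ·-e𝟎-vanishes : ∀ {r} c (b : Vec Carrier r) → (c * e (𝟎 r) b) · b ≡ 𝟎 r
  ·-e𝟎-vanishes {r} c b with ≡-dec _≟_ b (𝟎 r)
  ... | yes refl = ·-𝟎 _
  ... | no  _    = trans (cong (_· b) (zeroʳ c)) (0#-· b)

  -- the closed form of Σₐ αₐ yₐ
  yCombination : ∀ {r} → (Vec Carrier r → Carrier) → Word r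
  yCombination {r} α b = (sumAll _+_ 0# r α * e (𝟎 r) b) + (- α b)

  permuted-yCombination : ∀ {r} (τ : Vec Carrier r ↔ Vec Carrier r) →
    Inverse.to τ (𝟎 r) ≡ 𝟎 r → ∀ α b →
    sumAll _+_ 0# r (λ a → α a * y (Inverse.to τ a) (Inverse.to τ b)) ≡ yCombination α b
  permuted-yCombination {r} τ τ𝟎 α b = begin
    ∑ (λ a → α a * y (T a) (T b))
      ≡⟨ sumAll-cong _+_ 0# r (λ a → x[y-z]≈xy-xz (α a) _ _) ⟩
    ∑ (λ a → (α a * e (𝟎 r) (T b)) + (- (α a * e (T a) (T b))))
      ≡⟨ sumAll-∙ +-isCommutativeMonoid r _ _ ⟩
    ∑ (λ a → α a * e (𝟎 r) (T b)) + ∑ (λ a → - (α a * e (T a) (T b)))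
      ≡⟨ cong₂ _+_ (sumAll-*ʳ r _ α) (sumAll-neg r _) ⟩
    (∑ α * e (𝟎 r) (T b)) + (- ∑ (λ a → α a * e (T a) (T b)))
      ≡⟨ cong₂ (λ c d → (∑ α * c) + (- d)) e𝟎-Tb
               (sumAll-cong _+_ 0# r (λ a → cong (α a *_) (e-injective T-injective a b))) ⟩
    (∑ α * e (𝟎 r) b) + (- ∑ (λ a → α a * e a b))
      ≡⟨ cong (λ d → (∑ α * e (𝟎 r) b) + (- d)) (sumAll-*-e r α b) ⟩
    yCombination α b ∎
    where
    ∑ : (Vec Carrier r → Carrier) → Carrier
    ∑ = sumAll _+_ 0# r
    T : Vec Carrier r → Vec Carrier r
    T = Inverse.to τ
    T-injective : Injective _≡_ _≡_ T
    T-injective = Injection.injective (↔⇒↣ τ)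
    e𝟎-Tb : e (𝟎 r) (T b) ≡ e (𝟎 r) b
    e𝟎-Tb = trans (cong (λ c → e c (T b)) (sym τ𝟎)) (e-injective T-injective (𝟎 r) b)

  sum-yCombination : ∀ r α → sumAll _+_ 0# r (yCombination α) ≡ 0#
  sum-yCombination r α = begin
    ∑ (λ b → (S * e (𝟎 r) b) + (- α b))         ≡⟨ sumAll-∙ +-isCommutativeMonoid r _ _ ⟩
    ∑ (λ b → S * e (𝟎 r) b) + ∑ (λ b → - α b)   ≡⟨ cong₂ _+_ (sumAll-*ˡ r S _) (sumAll-neg r α) ⟩
    (S * ∑ (e (𝟎 r))) + (- S)                    ≡⟨ cong (λ c → (S * c) + (- S)) (sumAll-e r (𝟎 r)) ⟩
    (S * 1#) + (- S)                             ≡⟨ cong (_+ (- S)) (*-identityʳ S) ⟩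
    S + (- S)                                    ≡⟨ -‿inverseʳ S ⟩
    0#                                           ∎
    where
    ∑ : (Vec Carrier r → Carrier) → Carrier
    ∑ = sumAll _+_ 0# r
    S : Carrier
    S = ∑ α

  moment-yCombination : ∀ r α →
    sumAll _⊕_ (𝟎 r) r (λ b → yCombination α b · b)
      ≡ (- 1#) · sumAll _⊕_ (𝟎 r) r (λ a → α a · a)
  moment-yCombination r α = begin
    ∑⃗ (λ b → ((S * e (𝟎 r) b) + (- α b)) · b)
      ≡⟨ sumAll-cong _⊕_ (𝟎 r) r (λ b → +-distrib-· _ _ b) ⟩
    ∑⃗ (λ b → ((S * e (𝟎 r) b) · b) ⊕ ((- α b) · b))
      ≡⟨ sumAll-∙ ⊕-CM r _ _ ⟩
    ∑⃗ (λ b → (S * e (𝟎 r) b) · b) ⊕ ∑⃗ (λ b → (- α b) · b)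
      ≡⟨ cong₂ _⊕_ (sumAll-ε ⊕-CM r (·-e𝟎-vanishes S))
                   (sumAll-cong _⊕_ (𝟎 r) r (λ b → -c·v≡-1·[c·v] (α b) b)) ⟩
    𝟎 r ⊕ ∑⃗ (λ b → (- 1#) · (α b · b))
      ≡⟨ IsCommutativeMonoid.identityˡ ⊕-CM _ ⟩
    ∑⃗ (λ b → (- 1#) · (α b · b))
      ≡⟨ sumAll-· r (- 1#) _ ⟩
    (- 1#) · ∑⃗ (λ a → α a · a) ∎
    where
    ∑⃗ : (Vec Carrier r → Vec Carrier r) → Vec Carrier r
    ∑⃗ = sumAll _⊕_ (𝟎 r) r
    S : Carrier
    S = sumAll _+_ 0# r α
    ⊕-CM : IsCommutativeMonoid _≡_ _⊕_ (𝟎 r)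
    ⊕-CM = ⊕-isCommutativeMonoid r

  yCombination∈D⇔ : ∀ r α →
                    InD r (yCombination α) ⇔ sumAll _⊕_ (𝟎 r) r (λ a → α a · a) ≡ 𝟎 r
  yCombination∈D⇔ r α = mk⇔
    (λ w∈D → Equivalence.to (-1·v≡𝟎⇔v≡𝟎 V)
               (trans (sym (moment-yCombination r α)) (proj₂ w∈D)))
    (λ V≡𝟎 → sum-yCombination r α
           , trans (moment-yCombination r α) (Equivalence.from (-1·v≡𝟎⇔v≡𝟎 V) V≡𝟎))
    where
    V : Vec Carrier r
    V = sumAll _⊕_ (𝟎 r) r (λ a → α a · a)

  InD-cong : ∀ r {w w′ : Word r} → w ≗ w′ → InD r w ⇔ InD r w′
  InD-cong r w≗w′ = mk⇔ (transport w≗w′) (transport (sym ∘ w≗w′))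
    where
    transport : ∀ {w w′ : Word r} → w ≗ w′ → InD r w → InD r w′
    transport w≗w′ (sum≡0 , moment≡𝟎) =
        trans (sym (sumAll-cong _+_ 0# r w≗w′)) sum≡0
      , trans (sym (sumAll-cong _⊕_ (𝟎 r) r (λ b → cong (_· b) (w≗w′ b)))) moment≡𝟎

  InτD⇔InD-pullback : ∀ r (τ : Vec Carrier r ↔ Vec Carrier r) (z : Word r) →
                      InτD r τ z ⇔ InD r (z ∘ Inverse.to τ)
  InτD⇔InD-pullback r τ z = mk⇔ pull push
    where
    open Inverse τ using (to; strictlyInverseˡ; strictlyInverseʳ)
    pull : InτD r τ z → InD r (z ∘ to)
    pull (w , w∈D , τw≗z) = Equivalence.to (InD-cong r w≗z∘τ) w∈D
      where
      w≗z∘τ : w ≗ z ∘ to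
      w≗z∘τ b = trans (cong w (sym (strictlyInverseʳ b))) (τw≗z (to b))
    push : InD r (z ∘ to) → InτD r τ z
    push z∘τ∈D = z ∘ to , z∘τ∈D , λ b → cong z (strictlyInverseˡ b)

open import Data.Nat using (_≤_; _*_; _∸_; _^_)
open FiniteField using (Carrier; size; 0#)

proposition1 : (F : FiniteField) → IsPrimePower (size F)
    → (r : ℕ) → 1 ≤ r
    → (n : ℕ) → n * (size F ∸ 1) ≡ size F ^ r ∸ 1
    → (H : Fin n → Vec (Carrier F) r) → FF.IsHammingMatrix F r n H
    → (τ : Vec (Carrier F) r ↔ Vec (Carrier F) r)
    → Inverse.to τ (FF.𝟎 F r) ≡ FF.𝟎 F r
    → (x : Vec (Carrier F) r → Vec (Carrier F) n)
    → (∀ a → FF.InCoset F H a (x a))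
    → (α : Vec (Carrier F) r → Carrier F)
    → (FF.InC F H (FF.sumAll F (FF._⊕_ F) (FF.𝟎 F n) r (λ a → FF._·_ F (α a) (x a)))
       ⇔ FF.InτD F r τ (λ b → FF.sumAll F (FiniteField._+_ F) (0# F) r
                                 (λ a → FiniteField._*_ F (α a) (FF.y F (Inverse.to τ a) b))))
proposition1 F _ r _ n _ H _ τ τ𝟎 x x∈Cₐ α =
  ⇔.trans syndrome≡𝟎⇔V≡𝟎
    (⇔.trans (⇔.sym (yCombination∈D⇔ r α))
      (⇔.trans (InD-cong r (sym ∘ permuted-yCombination τ τ𝟎 α))
        (⇔.sym (InτD⇔InD-pullback r τ _))))
  where
  open FF F
  open Sums F
  open Vectors F
  open Words F
  V : Vec (Carrier F) r
  V = sumAll _⊕_ (𝟎 r) r (λ a → α a · a)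
  syndrome≡V : syndrome H (sumAll _⊕_ (𝟎 n) r (λ a → α a · x a)) ≡ V
  syndrome≡V = trans (syndrome-linearCombination H r α x)
                     (sumAll-cong _⊕_ (𝟎 r) r (λ a → cong (α a ·_) (x∈Cₐ a)))
  syndrome≡𝟎⇔V≡𝟎 : InC H (sumAll _⊕_ (𝟎 n) r (λ a → α a · x a)) ⇔ V ≡ 𝟎 r
  syndrome≡𝟎⇔V≡𝟎 = mk⇔ (trans (sym syndrome≡V)) (trans syndrome≡V)
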